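{- For every integer $n \geq 3$, the digraph $\overrightarrow{K_n}$ is antimagic.
   Context: For $n\ge 2$, $\overrightarrow{K_n}$ is the directed graph with vertex set $\{v_1,\dots,v_n\}$ having, for every pair $1\le i<j\le n$, exactly one arc, directed from $v_i$ to $v_j$; it has $l=\binom{n}{2}$ arcs. An antimagic labeling of a directed graph with $n$ vertices and $l$ arcs is a bijection $f$ from its arc set to $\{1,2,\dots,l\}$ such that the $n$ vertex sums are pairwise distinct, where the vertex sum of a vertex $v$ is $S_v=S_v^-+S_v^+$, with $S_v^-$ the sum of $f$ over all arcs entering $v$ and $S_v^+$ the sum of $f$ over all arcs leaving $v$. A directed graph is antimagic if it admits an antimagic labeling. -}

module Defs where

open import Data.Nat using (ℕ; suc; _+_)
open import Data.Nat.Combinatorics using (_C_)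
open import Data.Fin using (Fin; toℕ; _<_; _<?_)
open import Data.List using (map; allFin)
open import Data.Nat.ListAction using (sum)
open import Data.Product using (Σ-syntax; _,_)
open import Relation.Nullary using (yes; no)
open import Relation.Binary.PropositionalEquality using (_≡_)
open import Function.Bundles using (_⤖_; Bijection)

-- Vertices of the transitive tournament K⃗ₙ are v₀,…,v_{n-1} (Fin n);
-- there is exactly one arc from vᵢ to vⱼ for every i < j.
Arc : ℕ → Set
Arc n = Σ[ i ∈ Fin n ] Σ[ j ∈ Fin n ] (i < j)

numArcs : ℕ → ℕ
numArcs n = n C 2

-- A labeling is a bijection from the arcs to Fin l; the arc a receives
-- label  1 + toℕ (f a) ∈ {1,…,l}.
Labeling : ℕ → Set
Labeling n = Arc n ⤖ Fin (numArcs n)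

label : ∀ {n} → Labeling n → Arc n → ℕ
label f a = suc (toℕ (Bijection.to f a))

arcLabel : ∀ {n} → Labeling n → Fin n → Fin n → ℕ
arcLabel f i j with i <? j
... | yes p = label f (i , j , p)
... | no _  = 0

outSum : ∀ {n} → Labeling n → Fin n → ℕ
outSum {n} f v = sum (map (λ j → arcLabel f v j) (allFin n))

inSum : ∀ {n} → Labeling n → Fin n → ℕ
inSum {n} f v = sum (map (λ i → arcLabel f i v) (allFin n))

vertexSum : ∀ {n} → Labeling n → Fin n → ℕ
vertexSum f v = inSum f v + outSum f v

IsAntimagicLabeling : ∀ {n} → Labeling n → Set
IsAntimagicLabeling {n} f = ∀ (u v : Fin n) → vertexSum f u ≡ vertexSum f v → u ≡ v

KnAntimagic : ℕ → Set
KnAntimagic n = Σ[ f ∈ Labeling n ] IsAntimagicLabeling f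

module Submission where

-- Label the arc vᵢ → vⱼ (i < j) by one more than the rank C(j,2) + i of {i, j} in the
-- colexicographic order of 2-subsets. Write S_u as a sum over the other endpoints x of the arcs
-- at u, and for u < v swap the summands of S_u indexed by u and v: the label of the arc uv then
-- sits at the same index in S_u and S_v, both sums have 0 at index v, and at every remaining
-- index x the arc ux has a smaller colex rank than vx. A third vertex makes S_u < S_v strict.

open import Defs
open import Data.Nat using (ℕ; zero; suc; _+_; _∸_; _≤_; _<_; _<?_; z≤n; s≤s; s<s)
open import Data.Nat.Properties
open import Data.Nat.Combinatorics using (_C_; nC1≡n; nCk+nC[k+1]≡[n+1]C[k+1])
open import Data.Fin as Fin using (Fin; toℕ; fromℕ<)
import Data.Fin.Properties as Fin
open import Data.Fin.Permutation.Components using (transpose)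
import Data.Fin.Permutation as Perm
open import Data.Fin.Patterns using (0F; 1F; 2F)
open import Data.Fin.Properties using (toℕ<n; toℕ-fromℕ<; toℕ-injective)
open import Data.List using (map; tabulate; allFin)
open import Data.List.Properties using (map-tabulate)
import Data.Nat.ListAction as List
open import Algebra.Properties.CommutativeMonoid.Sum +-0-commutativeMonoid
  using (sum-syntax; ∑-distrib-+; sum-permute)
open import Data.Product using (∃; ∃₂; _×_; _,_)
open import Data.Sum using (_⊎_; inj₁; inj₂)
open import Relation.Nullary using (yes; no; ¬_; contradiction)
open import Relation.Binary using (tri<; tri≈; tri>)
open import Relation.Binary.PropositionalEquality
open import Function.Base using (id; _∘_)
open import Function.Bundles using (mk⤖)
open import Function.Definitions using (Injective; Surjective)

[1+n]C2≡nC2+n : ∀ n → suc n C 2 ≡ n C 2 + n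
[1+n]C2≡nC2+n n = begin
  suc n C 2       ≡⟨ nCk+nC[k+1]≡[n+1]C[k+1] n 1 ⟨
  n C 1 + n C 2   ≡⟨ cong (_+ n C 2) (nC1≡n n) ⟩
  n + n C 2       ≡⟨ +-comm n _ ⟩
  n C 2 + n       ∎
  where open ≡-Reasoning

C2-mono-≤ : ∀ {m n} → m ≤ n → m C 2 ≤ n C 2
C2-mono-≤ {n = zero}  z≤n = ≤-refl
C2-mono-≤ {m} {suc n} m≤1+n with m≤n⇒m<n∨m≡n m≤1+n
... | inj₂ refl      = ≤-refl
... | inj₁ (s≤s m≤n) = ≤-trans (C2-mono-≤ m≤n)
  (≤-trans (m≤m+n (n C 2) n) (≤-reflexive (sym ([1+n]C2≡nC2+n n))))

colex : ℕ → ℕ → ℕ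
colex i j = j C 2 + i

colex-<-C2 : ∀ {i j n} → i < j → j < n → colex i j < n C 2
colex-<-C2 {i} {j} {n} i<j j<n = begin-strict
  j C 2 + i       <⟨ +-monoʳ-< (j C 2) i<j ⟩
  j C 2 + j       ≡⟨ [1+n]C2≡nC2+n j ⟨
  suc j C 2       ≤⟨ C2-mono-≤ j<n ⟩
  n C 2           ∎
  where open ≤-Reasoning

colex-<-colex : ∀ {i j i′ j′} → i < j → j < j′ → colex i j < colex i′ j′
colex-<-colex {i′ = i′} {j′} i<j j<j′ = <-≤-trans (colex-<-C2 i<j j<j′) (m≤m+n (j′ C 2) i′)

colex-injective : ∀ {i j i′ j′} → i < j → i′ < j′ →
                  colex i j ≡ colex i′ j′ → i ≡ i′ × j ≡ j′
colex-injective {i} {j} {i′} {j′} i<j i′<j′ eq with <-cmp j j′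
... | tri< j<j′ _ _ = contradiction eq (<⇒≢ (colex-<-colex i<j j<j′))
... | tri> _ _ j′<j = contradiction (sym eq) (<⇒≢ (colex-<-colex i′<j′ j′<j))
... | tri≈ _ refl _ = +-cancelˡ-≡ (j C 2) i i′ eq , refl

colex-surjective : ∀ n {k} → k < n C 2 → ∃₂ λ i j → i < j × j < n × colex i j ≡ k
colex-surjective zero ()
colex-surjective (suc n) {k} k<[1+n]C2 with k <? n C 2
... | yes k<nC2 with colex-surjective n k<nC2
...   | i , j , i<j , j<n , eq = i , j , i<j , m<n⇒m<1+n j<n , eq
colex-surjective (suc n) {k} k<[1+n]C2 | no k≮nC2 =
  k ∸ n C 2 , n , +-cancelˡ-< (n C 2) _ _ bound , n<1+n n , m+[n∸m]≡n nC2≤k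
  where
  nC2≤k : n C 2 ≤ k
  nC2≤k = ≮⇒≥ k≮nC2
  bound : n C 2 + (k ∸ n C 2) < n C 2 + n
  bound = subst₂ _<_ (sym (m+[n∸m]≡n nC2≤k)) ([1+n]C2≡nC2+n n) k<[1+n]C2

arcRank : ∀ {n} → Arc n → Fin (numArcs n)
arcRank (i , j , i<j) = fromℕ< (colex-<-C2 i<j (toℕ<n j))

toℕ-arcRank : ∀ {n} i j (i<j : i Fin.< j) → toℕ (arcRank {n} (i , j , i<j)) ≡ colex (toℕ i) (toℕ j)
toℕ-arcRank i j i<j = toℕ-fromℕ< _

arcRank-injective : ∀ {n} → Injective _≡_ _≡_ (arcRank {n})
arcRank-injective {x = i , j , i<j} {i′ , j′ , i′<j′} eq
  with colex-injective i<j i′<j′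
         (trans (sym (toℕ-arcRank i j i<j)) (trans (cong toℕ eq) (toℕ-arcRank i′ j′ i′<j′)))
... | i≡i′ , j≡j′ with toℕ-injective i≡i′ | toℕ-injective j≡j′
...   | refl | refl = cong (λ p → i , j , p) (<-irrelevant i<j i′<j′)

arcRank-surjective : ∀ {n} → Surjective _≡_ _≡_ (arcRank {n})
arcRank-surjective {n} k with colex-surjective n (toℕ<n k)
... | i , j , i<j , j<n , eq = arc , λ { refl → toℕ-injective rank≡k }
  where
  i<n : i < n
  i<n = <-trans i<j j<n
  fin-i<j : fromℕ< i<n Fin.< fromℕ< j<n
  fin-i<j = subst₂ _<_ (sym (toℕ-fromℕ< i<n)) (sym (toℕ-fromℕ< j<n)) i<j
  arc : Arc n
  arc = fromℕ< i<n , fromℕ< j<n , fin-i<j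
  rank≡k : toℕ (arcRank arc) ≡ toℕ k
  rank≡k = trans (toℕ-arcRank (fromℕ< i<n) (fromℕ< j<n) fin-i<j)
                 (trans (cong₂ colex (toℕ-fromℕ< i<n) (toℕ-fromℕ< j<n)) eq)

colexLabeling : ∀ n → Labeling n
colexLabeling n = mk⤖ (arcRank-injective , arcRank-surjective)

arcLabel-≮ : ∀ {n} (f : Labeling n) {i j} → ¬ i Fin.< j → arcLabel f i j ≡ 0
arcLabel-≮ f {i} {j} i≮j with i Fin.<? j
... | yes i<j = contradiction i<j i≮j
... | no _    = refl

-- arcLabel vanishes in the direction that is not an arc, so this is the label of the arc
-- joining v and x, and 0 when x = v.
edgeLabel : ∀ {n} → Labeling n → Fin n → Fin n → ℕ
edgeLabel f v x = arcLabel f x v + arcLabel f v x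

edgeLabel-sym : ∀ {n} (f : Labeling n) u v → edgeLabel f u v ≡ edgeLabel f v u
edgeLabel-sym f u v = +-comm (arcLabel f v u) (arcLabel f u v)

edgeLabel-refl : ∀ {n} (f : Labeling n) v → edgeLabel f v v ≡ 0
edgeLabel-refl f v = cong (λ k → k + k) (arcLabel-≮ f {v} {v} (<-irrefl refl))

sum-tabulate : ∀ {n} (g : Fin n → ℕ) → List.sum (tabulate g) ≡ ∑[ i < n ] g i
sum-tabulate {zero}  g = refl
sum-tabulate {suc n} g = cong (g Fin.zero +_) (sum-tabulate (g ∘ Fin.suc))

sum-map-allFin : ∀ {n} (g : Fin n → ℕ) → List.sum (map g (allFin n)) ≡ ∑[ i < n ] g i
sum-map-allFin g = trans (cong List.sum (map-tabulate id g)) (sum-tabulate g)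

∑-mono-≤ : ∀ {n} {g h : Fin n → ℕ} → (∀ i → g i ≤ h i) → ∑[ i < n ] g i ≤ ∑[ i < n ] h i
∑-mono-≤ {zero}  g≤h = z≤n
∑-mono-≤ {suc n} g≤h = +-mono-≤ (g≤h Fin.zero) (∑-mono-≤ (g≤h ∘ Fin.suc))

∑-mono-< : ∀ {n} {g h : Fin n → ℕ} → (∀ i → g i ≤ h i) → ∀ k → g k < h k →
           ∑[ i < n ] g i < ∑[ i < n ] h i
∑-mono-< g≤h Fin.zero    gk<hk = +-mono-<-≤ gk<hk (∑-mono-≤ (g≤h ∘ Fin.suc))
∑-mono-< g≤h (Fin.suc k) gk<hk = +-mono-≤-< (g≤h Fin.zero) (∑-mono-< (g≤h ∘ Fin.suc) k gk<hk)

vertexSum≡∑edgeLabel : ∀ {n} (f : Labeling n) v → vertexSum f v ≡ ∑[ x < n ] edgeLabel f v x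
vertexSum≡∑edgeLabel f v = trans
  (cong₂ _+_ (sum-map-allFin (λ x → arcLabel f x v)) (sum-map-allFin (arcLabel f v)))
  (sym (∑-distrib-+ (λ x → arcLabel f x v) (arcLabel f v)))

transpose-cases : ∀ {n} (i j k : Fin n) →
  (k ≡ i × transpose i j k ≡ j) ⊎ (k ≡ j × transpose i j k ≡ i) ⊎ (k ≢ i × k ≢ j × transpose i j k ≡ k)
transpose-cases i j k with k Fin.≟ i
... | yes k≡i = inj₁ (k≡i , refl)
... | no k≢i with k Fin.≟ j
...   | yes k≡j = inj₂ (inj₁ (k≡j , refl))
...   | no k≢j  = inj₂ (inj₂ (k≢i , k≢j , refl))

arcLabel-colex : ∀ {n} {i j : Fin n} → i Fin.< j →
                 arcLabel (colexLabeling n) i j ≡ suc (colex (toℕ i) (toℕ j))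
arcLabel-colex {i = i} {j} i<j with i Fin.<? j
... | yes i<′j = cong suc (toℕ-arcRank i j i<′j)
... | no i≮j   = contradiction i<j i≮j

module _ {n : ℕ} where

  private
    L : Labeling n
    L = colexLabeling n

  edgeLabel-colex-< : {v x : Fin n} → x Fin.< v → edgeLabel L v x ≡ suc (colex (toℕ x) (toℕ v))
  edgeLabel-colex-< x<v = trans (cong₂ _+_ (arcLabel-colex x<v) (arcLabel-≮ L (<-asym x<v)))
                                (+-identityʳ _)

  edgeLabel-colex-> : {v x : Fin n} → v Fin.< x → edgeLabel L v x ≡ suc (colex (toℕ v) (toℕ x))
  edgeLabel-colex-> v<x = cong₂ _+_ (arcLabel-≮ L (<-asym v<x)) (arcLabel-colex v<x)

  edgeLabel-colex-mono : ∀ {u v x : Fin n} → u Fin.< v → x ≢ u → x ≢ v →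
                         edgeLabel L u x < edgeLabel L v x
  edgeLabel-colex-mono {u} {v} {x} u<v x≢u x≢v with Fin.<-cmp x u
  ... | tri≈ _ x≡u _ = contradiction x≡u x≢u
  ... | tri< x<u _ _ rewrite edgeLabel-colex-< x<u | edgeLabel-colex-< (<-trans x<u u<v) =
    s<s (colex-<-colex x<u u<v)
  ... | tri> _ _ u<x rewrite edgeLabel-colex-> u<x with Fin.<-cmp x v
  ...   | tri≈ _ x≡v _ = contradiction x≡v x≢v
  ...   | tri< x<v _ _ rewrite edgeLabel-colex-< x<v = s<s (colex-<-colex u<x x<v)
  ...   | tri> _ _ v<x rewrite edgeLabel-colex-> v<x = s<s (+-monoʳ-< (toℕ x C 2) u<v)

  vertexSum-colex-< : ∀ {u v w : Fin n} → u Fin.< v → w ≢ u → w ≢ v → vertexSum L u < vertexSum L v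
  vertexSum-colex-< {u} {v} {w} u<v w≢u w≢v = begin-strict
    vertexSum L u                          ≡⟨ vertexSum≡∑edgeLabel L u ⟩
    ∑[ x < n ] edgeLabel L u x             ≡⟨ sum-permute (edgeLabel L u) (Perm.transpose u v) ⟩
    ∑[ x < n ] edgeLabel L u (τ x)         <⟨ ∑-mono-< dominated w (elsewhere w w≢u w≢v) ⟩
    ∑[ x < n ] edgeLabel L v x             ≡⟨ vertexSum≡∑edgeLabel L v ⟨
    vertexSum L v                          ∎
    where
    open ≤-Reasoning
    τ : Fin n → Fin n
    τ = transpose u v
    elsewhere : ∀ x → x ≢ u → x ≢ v → edgeLabel L u (τ x) < edgeLabel L v x
    elsewhere x x≢u x≢v with transpose-cases u v x
    ... | inj₁ (x≡u , _)               = contradiction x≡u x≢u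
    ... | inj₂ (inj₁ (x≡v , _))        = contradiction x≡v x≢v
    ... | inj₂ (inj₂ (_ , _ , τx≡x))   rewrite τx≡x = edgeLabel-colex-mono u<v x≢u x≢v
    dominated : ∀ x → edgeLabel L u (τ x) ≤ edgeLabel L v x
    dominated x with transpose-cases u v x
    ... | inj₁ (refl , τu≡v)           rewrite τu≡v = ≤-reflexive (edgeLabel-sym L u v)
    ... | inj₂ (inj₁ (refl , τv≡u))    rewrite τv≡u =
      ≤-reflexive (trans (edgeLabel-refl L u) (sym (edgeLabel-refl L v)))
    ... | inj₂ (inj₂ (x≢u , x≢v , _))  = <⇒≤ (elsewhere x x≢u x≢v)

<-mono⇒injective : ∀ {n} {g : Fin n → ℕ} → (∀ {u v} → u Fin.< v → g u < g v) → Injective _≡_ _≡_ g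
<-mono⇒injective g-mono {u} {v} gu≡gv with Fin.<-cmp u v
... | tri< u<v _ _ = contradiction gu≡gv (<⇒≢ (g-mono u<v))
... | tri≈ _ u≡v _ = u≡v
... | tri> _ _ v<u = contradiction (sym gu≡gv) (<⇒≢ (g-mono v<u))

third-vertex : ∀ {m} (u v : Fin (3 + m)) → ∃ λ w → w ≢ u × w ≢ v
third-vertex 0F                    0F                    = 1F , (λ ()) , (λ ())
third-vertex 0F                    1F                    = 2F , (λ ()) , (λ ())
third-vertex 0F                    (Fin.suc (Fin.suc _)) = 1F , (λ ()) , (λ ())
third-vertex 1F                    0F                    = 2F , (λ ()) , (λ ())
third-vertex (Fin.suc (Fin.suc _)) 0F                    = 1F , (λ ()) , (λ ())
third-vertex (Fin.suc _)           (Fin.suc _)           = 0F , (λ ()) , (λ ())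

colexLabeling-antimagic : ∀ m → IsAntimagicLabeling (colexLabeling (3 + m))
colexLabeling-antimagic m u v = <-mono⇒injective vertexSum-<
  where
  vertexSum-< : ∀ {u v} → u Fin.< v → vertexSum (colexLabeling (3 + m)) u < vertexSum (colexLabeling (3 + m)) v
  vertexSum-< {u} {v} u<v with third-vertex u v
  ... | w , w≢u , w≢v = vertexSum-colex-< u<v w≢u w≢v

theorem2 : (n : ℕ) → 3 ≤ n → KnAntimagic n
theorem2 zero                 ()
theorem2 (suc zero)           (s≤s ())
theorem2 (suc (suc zero))     (s≤s (s≤s ()))
theorem2 (suc (suc (suc m))) _ = colexLabeling _ , colexLabeling-antimagic m
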